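{- Let $k\ge2$ be an integer. (a) If $b=k^2$, then $[0,k]_b$ and $[1,k]_b$ are $1$-cycles of $S_{x^3,b}$. (b) If $b=(3k+1)^2$, then $[2k+1,k+1]_b$ is a $1$-cycle of $S_{x^3,b}$. (c) If $b=(3k+2)^2$, then $[2k+1,k]_b$ is a $1$-cycle of $S_{x^3,b}$. (d) If $b=(3k)^2$, then $[0,6k^2+k,3k^2+2k]_b$, $[1,6k^2+k,3k^2+2k]_b$, $[0,6k^2-k,3k^2-2k]_b$ and $[1,6k^2-k,3k^2-2k]_b$ are $1$-cycles of $S_{x^3,b}$.
   Context: For an integer $b\ge2$, $[x_0,x_1,\dots,x_d]_b$ denotes the integer $x_0+x_1b+\dots+x_db^d$ (digits listed from least significant, $0\le x_i<b$). $S_{x^3,b}(n)=x_0^3+\dots+x_d^3$ where $n=[x_0,\dots,x_d]_b$ is the base-$b$ expansion of $n$. A $1$-cycle of $S_{x^3,b}$ is a positive integer $n$ with $S_{x^3,b}(n)=n$. -}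

module Defs where

open import Data.Nat using (ℕ; zero; suc; _+_; _*_; _^_; _<_; NonZero)
open import Data.Nat.DivMod using (_/_; _%_)
open import Data.List using (List; []; _∷_)
open import Data.Product using (_×_)
open import Relation.Binary.PropositionalEquality using (_≡_)

-- [x₀, x₁, …, x_d]_b = x₀ + x₁ b + … + x_d b^d  (least significant digit first)
digitsVal : ℕ → List ℕ → ℕ
digitsVal b []       = 0
digitsVal b (x ∷ xs) = x + b * digitsVal b xs

-- Sum of cubes of the base-b digits of n, computed by repeated division.
-- The fuel argument bounds the number of digits; fuel = n suffices for b ≥ 2
-- since n / b < n for n > 0.
cubeDigitSumAux : (b : ℕ) → .{{NonZero b}} → ℕ → ℕ → ℕ
cubeDigitSumAux b zero    n         = 0
cubeDigitSumAux b (suc f) zero      = 0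
cubeDigitSumAux b (suc f) n@(suc _) = (n % b) ^ 3 + cubeDigitSumAux b f (n / b)

-- S_{x^3,b}(n) = sum of cubes of the base-b digits of n.
-- Only meaningful for b ≥ 2 (the paper's standing assumption); for b < 2 it is
-- set to 0 as a junk value and is never used.
S³ : ℕ → ℕ → ℕ
S³ zero          n = 0
S³ (suc zero)    n = 0
S³ b@(suc (suc _)) n = cubeDigitSumAux b n n

IsOneCycle : ℕ → ℕ → Set
IsOneCycle b n = (0 < n) × (S³ b n ≡ n)

{-# OPTIONS --safe #-}
-- When every digit of ds is below b, repeated division by b reads ds back off
-- digitsVal b ds, so S³ b (digitsVal b ds) is the sum of the cubes of ds.  Each
-- claimed 1-cycle is then a polynomial identity in k, e.g.
-- (2k+1)³ + (k+1)³ = (2k+1) + (3k+1)²(k+1), plus the bounds on its digits.  In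
-- (a) and (d) the identity only involves the higher digits, since the lowest
-- digit, 0 or 1, is its own cube.
module Submission where

open import Defs
open import Data.Nat using (ℕ; zero; suc; _+_; _*_; _∸_; _^_; _≤_; _<_; z≤n; s≤s; z<s; s≤s⁻¹; NonZero; >-nonZero)
open import Data.Nat.Properties
open import Data.Nat.DivMod using (_/_; _%_; %-remove-+ʳ; +-distrib-/-∣ʳ; m<n⇒m%n≡m; m<n⇒m/n≡0; m*n/n≡m)
open import Data.Nat.Divisibility using (m∣m*n)
open import Data.Nat.ListAction using (sum)
open import Data.List using (List; []; _∷_; map)
open import Data.List.Relation.Unary.All using (All; []; _∷_)
open import Data.Product using (_×_; _,_; assocʳ′)
open import Relation.Nullary using (yes; no)
open import Relation.Binary.PropositionalEquality
open import Data.Nat.Tactic.RingSolver using (solve-∀)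

cube : ℕ → ℕ
cube x = x * x * x

sumCubes : List ℕ → ℕ
sumCubes ds = sum (map cube ds)

^3≡cube : ∀ x → x ^ 3 ≡ cube x
^3≡cube x = trans (cong (λ y → x * (x * y)) (*-identityʳ x)) (sym (*-assoc x x x))

module _ (b : ℕ) .{{_ : NonZero b}} where

  digitsVal-∷-% : ∀ {x} ds → x < b → digitsVal b (x ∷ ds) % b ≡ x
  digitsVal-∷-% {x} ds x<b = trans (%-remove-+ʳ x (m∣m*n (digitsVal b ds))) (m<n⇒m%n≡m x<b)

  digitsVal-∷-/ : ∀ {x} ds → x < b → digitsVal b (x ∷ ds) / b ≡ digitsVal b ds
  digitsVal-∷-/ {x} ds x<b = begin
    (x + b * v) / b     ≡⟨ +-distrib-/-∣ʳ x (m∣m*n v) ⟩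
    x / b + b * v / b   ≡⟨ cong₂ _+_ (m<n⇒m/n≡0 x<b) (cong (_/ b) (*-comm b v)) ⟩
    v * b / b           ≡⟨ m*n/n≡m v b ⟩
    v                   ∎
    where
    open ≡-Reasoning
    v = digitsVal b ds

  sumCubes-digitsVal≡0 : ∀ ds → digitsVal b ds ≡ 0 → sumCubes ds ≡ 0
  sumCubes-digitsVal≡0 []       _  = refl
  sumCubes-digitsVal≡0 (x ∷ ds) eq = cong₂ _+_ (cong cube x≡0) (sumCubes-digitsVal≡0 ds ds≡0)
    where
    x≡0 : x ≡ 0
    x≡0 = m+n≡0⇒m≡0 x eq
    ds≡0 : digitsVal b ds ≡ 0
    ds≡0 = m*n≡0⇒m≡0 (digitsVal b ds) b (trans (*-comm (digitsVal b ds) b) (m+n≡0⇒n≡0 x eq))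

  digitsVal-tail< : 1 < b → ∀ x ds → 0 < digitsVal b (x ∷ ds) → digitsVal b ds < digitsVal b (x ∷ ds)
  digitsVal-tail< 1<b x ds 0<n with digitsVal b ds
  ... | zero      = 0<n
  ... | v@(suc _) = <-≤-trans (m<m*n v b 1<b) (≤-trans (≤-reflexive (*-comm v b)) (m≤n+m (b * v) x))

  cubeDigitSumAux-0 : ∀ f → cubeDigitSumAux b f 0 ≡ 0
  cubeDigitSumAux-0 zero    = refl
  cubeDigitSumAux-0 (suc f) = refl

  cubeDigitSumAux-suc : ∀ f n → 0 < n → cubeDigitSumAux b (suc f) n ≡ (n % b) ^ 3 + cubeDigitSumAux b f (n / b)
  cubeDigitSumAux-suc f (suc n) _ = refl

  cubeDigitSumAux-digitsVal≡0 : ∀ f ds → digitsVal b ds ≡ 0 → cubeDigitSumAux b f (digitsVal b ds) ≡ sumCubes ds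
  cubeDigitSumAux-digitsVal≡0 f ds n≡0 =
    trans (cong (cubeDigitSumAux b f) n≡0) (trans (cubeDigitSumAux-0 f) (sym (sumCubes-digitsVal≡0 ds n≡0)))

  cubeDigitSumAux-digitsVal : 1 < b → ∀ f ds → All (_< b) ds → digitsVal b ds ≤ f →
                              cubeDigitSumAux b f (digitsVal b ds) ≡ sumCubes ds
  cubeDigitSumAux-digitsVal _ f [] _ _ = cubeDigitSumAux-0 f
  cubeDigitSumAux-digitsVal _ zero ds _ n≤0 = cubeDigitSumAux-digitsVal≡0 zero ds (n≤0⇒n≡0 n≤0)
  cubeDigitSumAux-digitsVal 1<b (suc f) (x ∷ ds) (x<b ∷ ds<b) n≤1+f with 0 <? digitsVal b (x ∷ ds)
  ... | no n≮0  = cubeDigitSumAux-digitsVal≡0 (suc f) (x ∷ ds) (n≤0⇒n≡0 (≮⇒≥ n≮0))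
  ... | yes 0<n = begin
    cubeDigitSumAux b (suc f) n                          ≡⟨ cubeDigitSumAux-suc f n 0<n ⟩
    (n % b) ^ 3 + cubeDigitSumAux b f (n / b)            ≡⟨ cong₂ (λ y m → y ^ 3 + cubeDigitSumAux b f m)
                                                              (digitsVal-∷-% ds x<b) (digitsVal-∷-/ ds x<b) ⟩
    x ^ 3 + cubeDigitSumAux b f (digitsVal b ds)         ≡⟨ cong₂ _+_ (^3≡cube x)
                                                              (cubeDigitSumAux-digitsVal 1<b f ds ds<b ds≤f) ⟩
    cube x + sumCubes ds                                 ∎
    where
    open ≡-Reasoning
    n = digitsVal b (x ∷ ds)
    ds≤f : digitsVal b ds ≤ f
    ds≤f = s≤s⁻¹ (<-≤-trans (digitsVal-tail< 1<b x ds 0<n) n≤1+f)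

S³-digitsVal : ∀ {b} → 2 ≤ b → ∀ ds → All (_< b) ds → S³ b (digitsVal b ds) ≡ sumCubes ds
S³-digitsVal 2≤b@(s≤s (s≤s z≤n)) ds ds<b = cubeDigitSumAux-digitsVal _ 2≤b _ ds ds<b ≤-refl

oneCycle-digits : ∀ {b} → 2 ≤ b → ∀ ds → All (_< b) ds → 0 < digitsVal b ds →
                  sumCubes ds ≡ digitsVal b ds → IsOneCycle b (digitsVal b ds)
oneCycle-digits 2≤b ds ds<b 0<n eq = 0<n , trans (S³-digitsVal 2≤b ds ds<b) eq

LowDigitOneCycles : ℕ → List ℕ → Set
LowDigitOneCycles b ds = IsOneCycle b (digitsVal b (0 ∷ ds)) × IsOneCycle b (digitsVal b (1 ∷ ds))

oneCycles-lowDigit : ∀ {b} → 2 ≤ b → ∀ ds → All (_< b) ds → 0 < digitsVal b ds →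
                     sumCubes ds ≡ b * digitsVal b ds → LowDigitOneCycles b ds
oneCycles-lowDigit {b} 2≤b ds ds<b 0<v eq =
  oneCycle-digits 2≤b (0 ∷ ds) (0<b ∷ ds<b) (0<x+b*v 0) eq ,
  oneCycle-digits 2≤b (1 ∷ ds) (2≤b ∷ ds<b) (0<x+b*v 1) (cong suc eq)
  where
  0<b : 0 < b
  0<b = <-trans z<s 2≤b
  0<x+b*v : ∀ x → 0 < x + b * digitsVal b ds
  0<x+b*v x = <-≤-trans 0<v (≤-trans (m≤n*m (digitsVal b ds) b {{>-nonZero 0<b}}) (m≤n+m _ x))

sumCubes-pair : ∀ x y → sumCubes (x ∷ y ∷ []) ≡ cube x + cube y
sumCubes-pair x y = cong (cube x +_) (+-identityʳ (cube y))

digitsVal-singleton : ∀ b x → digitsVal b (x ∷ []) ≡ x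
digitsVal-singleton b x = trans (cong (x +_) (*-zeroʳ b)) (+-identityʳ x)

digitsVal-pair : ∀ b x y → digitsVal b (x ∷ y ∷ []) ≡ x + b * y
digitsVal-pair b x y = cong (λ v → x + b * v) (digitsVal-singleton b y)

oneCycle-twoDigits : ∀ {b x y} → 0 < x → x < b → y < b → cube x + cube y ≡ x + b * y →
                     IsOneCycle b (digitsVal b (x ∷ y ∷ []))
oneCycle-twoDigits {b} {x} {y} 0<x x<b y<b eq =
  oneCycle-digits (≤-<-trans 0<x x<b) (x ∷ y ∷ []) (x<b ∷ y<b ∷ []) (<-≤-trans 0<x (m≤m+n x _))
    (trans (sumCubes-pair x y) (trans eq (sym (digitsVal-pair b x y))))

oneCycles-lowDigit-pair : ∀ {b u v} → 0 < u → u < b → v < b → cube u + cube v ≡ b * (u + b * v) →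
                          LowDigitOneCycles b (u ∷ v ∷ [])
oneCycles-lowDigit-pair {b} {u} {v} 0<u u<b v<b eq =
  oneCycles-lowDigit (≤-<-trans 0<u u<b) (u ∷ v ∷ []) (u<b ∷ v<b ∷ []) (<-≤-trans 0<u (m≤m+n u _))
    (trans (sumCubes-pair u v) (trans eq (cong (b *_) (sym (digitsVal-pair b u v)))))

-- Digit bounds are proved as b = x + suc d with k = 1 + t, so that the gap d is a
-- polynomial in t with nonnegative coefficients.
<-of-+suc : ∀ {x n} d → x + suc d ≡ n → x < n
<-of-+suc {x} d eq = subst (x <_) eq (m<m+n x z<s)

oneCycles-base-k² : ∀ k → 2 ≤ k → LowDigitOneCycles (k * k) (k ∷ [])
oneCycles-base-k² k@(suc _) 2≤k = oneCycles-lowDigit (≤-trans 2≤k (<⇒≤ k<k*k)) (k ∷ []) (k<k*k ∷ []) z<s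
  (trans (+-identityʳ (cube k)) (cong (k * k *_) (sym (digitsVal-singleton (k * k) k))))
  where
  k<k*k : k < k * k
  k<k*k = m<m*n k k 2≤k

oneCycle-base-[3k+1]² : ∀ k .{{_ : NonZero k}} →
  IsOneCycle ((3 * k + 1) * (3 * k + 1)) (digitsVal ((3 * k + 1) * (3 * k + 1)) ((2 * k + 1) ∷ (k + 1) ∷ []))
oneCycle-base-[3k+1]² k@(suc t) =
  oneCycle-twoDigits z<s (<-of-+suc _ (low-digit-gap t)) (<-of-+suc _ (high-digit-gap t)) (cubes k)
  where
  cubes : ∀ k → let x = 2 * k + 1; y = k + 1 in x * x * x + y * y * y ≡ x + (3 * k + 1) * (3 * k + 1) * y
  cubes = solve-∀
  low-digit-gap : ∀ t → let k = 1 + t in (2 * k + 1) + suc (9 * t * t + 22 * t + 12) ≡ (3 * k + 1) * (3 * k + 1)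
  low-digit-gap = solve-∀
  high-digit-gap : ∀ t → let k = 1 + t in (k + 1) + suc (9 * t * t + 23 * t + 13) ≡ (3 * k + 1) * (3 * k + 1)
  high-digit-gap = solve-∀

oneCycle-base-[3k+2]² : ∀ k .{{_ : NonZero k}} →
  IsOneCycle ((3 * k + 2) * (3 * k + 2)) (digitsVal ((3 * k + 2) * (3 * k + 2)) ((2 * k + 1) ∷ k ∷ []))
oneCycle-base-[3k+2]² k@(suc t) =
  oneCycle-twoDigits z<s (<-of-+suc _ (low-digit-gap t)) (<-of-+suc _ (high-digit-gap t)) (cubes k)
  where
  cubes : ∀ k → let x = 2 * k + 1 in x * x * x + k * k * k ≡ x + (3 * k + 2) * (3 * k + 2) * k
  cubes = solve-∀
  low-digit-gap : ∀ t → let k = 1 + t in (2 * k + 1) + suc (9 * t * t + 28 * t + 21) ≡ (3 * k + 2) * (3 * k + 2)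
  low-digit-gap = solve-∀
  high-digit-gap : ∀ t → let k = 1 + t in k + suc (9 * t * t + 29 * t + 23) ≡ (3 * k + 2) * (3 * k + 2)
  high-digit-gap = solve-∀

oneCycles-base-[3k]²₊ : ∀ k .{{_ : NonZero k}} →
  LowDigitOneCycles (3 * k * (3 * k)) ((6 * (k * k) + k) ∷ (3 * (k * k) + 2 * k) ∷ [])
oneCycles-base-[3k]²₊ k@(suc t) =
  oneCycles-lowDigit-pair z<s (<-of-+suc _ (middle-digit-gap t)) (<-of-+suc _ (high-digit-gap t)) (cubes k)
  where
  cubes : ∀ k → let u = 6 * (k * k) + k; v = 3 * (k * k) + 2 * k; b = 3 * k * (3 * k) in
          u * u * u + v * v * v ≡ b * (u + b * v)
  cubes = solve-∀
  middle-digit-gap : ∀ t → let k = 1 + t in (6 * (k * k) + k) + suc (3 * t * t + 5 * t + 1) ≡ 3 * k * (3 * k)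
  middle-digit-gap = solve-∀
  high-digit-gap : ∀ t → let k = 1 + t in (3 * (k * k) + 2 * k) + suc (6 * t * t + 10 * t + 3) ≡ 3 * k * (3 * k)
  high-digit-gap = solve-∀

oneCycles-base-[3k]²₋ : ∀ k .{{_ : NonZero k}} →
  LowDigitOneCycles (3 * k * (3 * k)) ((6 * (k * k) ∸ k) ∷ (3 * (k * k) ∸ 2 * k) ∷ [])
oneCycles-base-[3k]²₋ k@(suc t) =
  subst₂ (λ u v → LowDigitOneCycles (3 * k * (3 * k)) (u ∷ v ∷ [])) (sym middle-digit) (sym high-digit)
    (oneCycles-lowDigit-pair {u = 5 + 11 * t + 6 * t * t} {v = 1 + 4 * t + 3 * t * t}
      z<s (<-of-+suc _ (middle-digit-gap t)) (<-of-+suc _ (high-digit-gap t)) (cubes t))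
  where
  middle-digit : 6 * (k * k) ∸ k ≡ 5 + 11 * t + 6 * t * t
  middle-digit = trans (cong (_∸ k) (6k²≡ t)) (m+n∸n≡m _ k)
    where
    6k²≡ : ∀ t → let k = 1 + t in 6 * (k * k) ≡ (5 + 11 * t + 6 * t * t) + k
    6k²≡ = solve-∀
  high-digit : 3 * (k * k) ∸ 2 * k ≡ 1 + 4 * t + 3 * t * t
  high-digit = trans (cong (_∸ 2 * k) (3k²≡ t)) (m+n∸n≡m _ (2 * k))
    where
    3k²≡ : ∀ t → let k = 1 + t in 3 * (k * k) ≡ (1 + 4 * t + 3 * t * t) + 2 * k
    3k²≡ = solve-∀
  cubes : ∀ t → let u = 5 + 11 * t + 6 * t * t; v = 1 + 4 * t + 3 * t * t; k = 1 + t; b = 3 * k * (3 * k) in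
          u * u * u + v * v * v ≡ b * (u + b * v)
  cubes = solve-∀
  middle-digit-gap : ∀ t → let k = 1 + t in (5 + 11 * t + 6 * t * t) + suc (3 * t * t + 7 * t + 3) ≡ 3 * k * (3 * k)
  middle-digit-gap = solve-∀
  high-digit-gap : ∀ t → let k = 1 + t in (1 + 4 * t + 3 * t * t) + suc (6 * t * t + 14 * t + 7) ≡ 3 * k * (3 * k)
  high-digit-gap = solve-∀

proposition5p4 : (k : ℕ) → 2 ≤ k →
      -- (a) b = k²
      (IsOneCycle (k * k) (digitsVal (k * k) (0 ∷ k ∷ []))
        × IsOneCycle (k * k) (digitsVal (k * k) (1 ∷ k ∷ [])))
      -- (b) b = (3k+1)²
      × IsOneCycle ((3 * k + 1) * (3 * k + 1))
          (digitsVal ((3 * k + 1) * (3 * k + 1)) ((2 * k + 1) ∷ (k + 1) ∷ []))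
      -- (c) b = (3k+2)²
      × IsOneCycle ((3 * k + 2) * (3 * k + 2))
          (digitsVal ((3 * k + 2) * (3 * k + 2)) ((2 * k + 1) ∷ k ∷ []))
      -- (d) b = (3k)²
      × (IsOneCycle ((3 * k) * (3 * k))
           (digitsVal ((3 * k) * (3 * k)) (0 ∷ (6 * (k * k) + k) ∷ (3 * (k * k) + 2 * k) ∷ []))
        × IsOneCycle ((3 * k) * (3 * k))
           (digitsVal ((3 * k) * (3 * k)) (1 ∷ (6 * (k * k) + k) ∷ (3 * (k * k) + 2 * k) ∷ []))
        × IsOneCycle ((3 * k) * (3 * k))
           (digitsVal ((3 * k) * (3 * k)) (0 ∷ (6 * (k * k) ∸ k) ∷ (3 * (k * k) ∸ 2 * k) ∷ []))
        × IsOneCycle ((3 * k) * (3 * k))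
           (digitsVal ((3 * k) * (3 * k)) (1 ∷ (6 * (k * k) ∸ k) ∷ (3 * (k * k) ∸ 2 * k) ∷ [])))
proposition5p4 k 2≤k@(s≤s (s≤s z≤n)) =
  oneCycles-base-k² k 2≤k ,
  oneCycle-base-[3k+1]² k ,
  oneCycle-base-[3k+2]² k ,
  assocʳ′ (oneCycles-base-[3k]²₊ k , oneCycles-base-[3k]²₋ k)
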